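{- Assume $G$ has girth at least $10hl$. For every $1\le j\le h$, the level $\mathcal{L}_j$ consists of $k(k-2)^{j-1}$ pairwise vertex-disjoint $l$-walks. Moreover, every $l$-walk in $\mathcal{L}_j$ intersects exactly one $l$-walk in $\mathcal{L}_0\cup\dots\cup\mathcal{L}_{j-1}$, namely its father.
   Context: $G$ is a $d$-regular graph on $n$ vertices, $l$ an integer with $l=\omega(1)$, $l=o(\log_d n)$, $h,k$ positive integers with $k\ge4$ (in the paper $k=\max\{4,\lfloor l/\sqrt{\log_d n}\rfloor\}$). An $l$-walk is a path of length $l$ in $G$ (identified with its vertex set); a path of length at most $l$ with endpoints $u,v$ is written $[u,v]$. For an $l$-walk $W$, $\mathcal{P}_k(W)=\{[u_i,u_{i+1}]:0\le i\le k-1\}$ is a partition of $W$ into $k$ consecutive edge-disjoint subpaths, $u_0,\dots,u_k$ in order along $W$, with $d(u_i,u_{i+1})\in\{\lfloor l/k\rfloor,\lceil l/k\rceil\}$. Witness construction: fix an $l$-walk $R$, $\mathcal{L}_0=\{R\}$. For each $P=[u_i,u_{i+1}]\in\mathcal{P}_k(R)$ let $W_P$ be an $l$-walk with $\emptyset\ne W_P\cap R\subseteq P\setminus\{u_i,u_{i+1}\}$ (father $R$); $\mathcal{L}_1=\{W_P:P\in\mathcal{P}_k(R)\}$. For $2\le i\le h$: for each $W\in\mathcal{L}_{i-1}$ with father $W'$, call $P\in\mathcal{P}_k(W)$ free if it shares no vertex with $W'$, let $\mathcal{P}^0_k(W)$ be a set of $k-2$ free subpaths, and for each $P=[u,v]\in\mathcal{P}^0_k(W)$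 let $W_P$ be an $l$-walk with $\emptyset\ne W_P\cap W\subseteq P\setminus\{u,v\}$ (father $W$); $\mathcal{L}_i=\bigcup_{W\in\mathcal{L}_{i-1}}\{W_P:P\in\mathcal{P}^0_k(W)\}$. All these walks are assumed to exist. -}

module Defs where

open import Data.Nat using (ℕ; zero; suc; _+_; _*_; _∸_; _^_; _≤_; _<_; NonZero)
open import Data.Nat.DivMod using (_/_)
open import Data.Bool using (Bool; true; false)
open import Data.Fin using (Fin; toℕ; inject₁; fromℕ)
import Data.Fin as F
open import Data.List using (List; []; _∷_; map; concatMap; allFin; length)
open import Data.List.Membership.Propositional using (_∈_)
open import Data.List.Relation.Unary.AllPairs using (AllPairs)
open import Data.Vec using (Vec; []; _∷_)
open import Data.Product using (Σ; _×_; _,_; ∃; ∃-syntax)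
open import Data.Sum using (_⊎_)
open import Relation.Binary.PropositionalEquality using (_≡_)
open import Relation.Nullary using (¬_)
open import Function.Definitions using (Injective)
open import Function.Bundles using (_⇔_)

record Graph (n : ℕ) : Set where
  field
    adj    : Fin n → Fin n → Bool
    sym    : ∀ u v → adj u v ≡ adj v u
    irrefl : ∀ v → adj v v ≡ false
open Graph public

Adj : ∀ {n} → Graph n → Fin n → Fin n → Set
Adj G u v = adj G u v ≡ true

degree : ∀ {n} → Graph n → Fin n → ℕ
degree {n} G v = length (Data.List.filterᵇ (adj G v) (allFin n))

Regular : ∀ {n} → Graph n → ℕ → Set
Regular {n} G d = ∀ (v : Fin n) → degree G v ≡ d

-- Paths of length l (= l-walks): l+1 distinct vertices, consecutive ones adjacent

record Path {n} (G : Graph n) (l : ℕ) : Set where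
  field
    vert : Fin (suc l) → Fin n
    step : ∀ (i : Fin l) → Adj G (vert (inject₁ i)) (vert (F.suc i))
    inj  : Injective _≡_ _≡_ vert
open Path public

-- vertex membership (a path is identified with its vertex set)
_∈P_ : ∀ {n} {G : Graph n} {l} → Fin n → Path G l → Set
v ∈P W = ∃[ t ] vert W t ≡ v

Meets : ∀ {n} {G : Graph n} {l} → Path G l → Path G l → Set
Meets X Y = ∃[ v ] (v ∈P X × v ∈P Y)

Disjoint : ∀ {n} {G : Graph n} {l} → Path G l → Path G l → Set
Disjoint X Y = ¬ Meets X Y

SameVertices : ∀ {n} {G : Graph n} {l} → Path G l → Path G l → Set
SameVertices X Y = ∀ v → (v ∈P X) ⇔ (v ∈P Y)

record Cycle {n} (G : Graph n) (m : ℕ) : Set where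
  field
    cv     : Fin (suc m) → Fin n
    cstep  : ∀ (i : Fin m) → Adj G (cv (inject₁ i)) (cv (F.suc i))
    closed : cv F.zero ≡ cv (fromℕ m)
    cinj   : Injective _≡_ _≡_ (λ (i : Fin m) → cv (inject₁ i))
    clen   : 3 ≤ m

GirthAtLeast : ∀ {n} → Graph n → ℕ → Set
GirthAtLeast G g = ∀ m → Cycle G m → g ≤ m

⌈_/_⌉ : (l k : ℕ) → {{NonZero k}} → ℕ
⌈ l / k ⌉ = (l + (k ∸ 1)) / k

-- positions u_0 = W(pos 0), ..., u_k = W(pos k) along the walk
record Partition (l k : ℕ) {{_ : NonZero k}} : Set where
  field
    pos    : Fin (suc k) → ℕ
    pos0   : pos F.zero ≡ 0
    posk   : pos (fromℕ k) ≡ l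
    mono   : ∀ (i : Fin k) → pos (inject₁ i) ≤ pos (F.suc i)
    len    : ∀ (i : Fin k) → (pos (F.suc i) ∸ pos (inject₁ i) ≡ l / k)
                           ⊎ (pos (F.suc i) ∸ pos (inject₁ i) ≡ ⌈ l / k ⌉)
open Partition public

module _ {n} {G : Graph n} {l k : ℕ} {{_ : NonZero k}} where

  Free : Path G l → Partition l k → Fin k → Path G l → Set
  Free W P i W' = ∀ (t : Fin (suc l)) → pos P (inject₁ i) ≤ toℕ t → toℕ t ≤ pos P (F.suc i)
                  → ¬ (vert W t ∈P W')

  AttachedTo : Path G l → Path G l → Partition l k → Fin k → Set
  AttachedTo X W P i = Meets X W
    × (∀ v → v ∈P X → v ∈P W →
         ∃[ t ] (vert W t ≡ v × pos P (inject₁ i) < toℕ t × toℕ t < pos P (F.suc i)))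

-- A walk of level (suc j) is addressed by (i , as) with i : Fin k the subpath of R
-- used at level 1 and as = (a_{j} ∷ ... ∷ a_1) the choices in P^0_k at levels 2..suc j
-- (most recent first).

Addr : ℕ → ℕ → Set
Addr k j = Fin k × Vec (Fin (k ∸ 2)) j

fatherOf : ∀ {n} {G : Graph n} {l k} → Path G l →
           ((j : ℕ) → Fin k → Vec (Fin (k ∸ 2)) j → Path G l) →
           (j : ℕ) → Fin k → Vec (Fin (k ∸ 2)) j → Path G l
fatherOf R W zero    i []       = R
fatherOf R W (suc j) i (_ ∷ as) = W j i as

addrs : (k j : ℕ) → List (Addr k j)
addrs k zero    = map (λ i → i , []) (allFin k)
addrs k (suc j) = concatMap (λ { (i , as) → map (λ a → i , (a ∷ as)) (allFin (k ∸ 2)) }) (addrs k j)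

levelOf : ∀ {n} {G : Graph n} {l k} → Path G l →
          ((j : ℕ) → Fin k → Vec (Fin (k ∸ 2)) j → Path G l) → ℕ → List (Path G l)
levelOf R W zero    = R ∷ []
levelOf {k = k} R W (suc j) = map (λ { (i , as) → W j i as }) (addrs k j)

record Construction {n} (G : Graph n) (l k h : ℕ) {{_ : NonZero k}} : Set where
  field
    R      : Path G l
    partR  : Partition l k
    W      : (j : ℕ) → Fin k → Vec (Fin (k ∸ 2)) j → Path G l      -- walk of level suc j
    partW  : (j : ℕ) → Fin k → Vec (Fin (k ∸ 2)) j → Partition l k
    sel    : (j : ℕ) → Fin k → Vec (Fin (k ∸ 2)) j → Fin (k ∸ 2) → Fin k
    level1  : ∀ (i : Fin k) → 1 ≤ h → AttachedTo (W 0 i []) R partR i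
    selInj  : ∀ j i as → suc j < h → Injective _≡_ _≡_ (sel j i as)
    selFree : ∀ j i as a → suc j < h →
              Free (W j i as) (partW j i as) (sel j i as a) (fatherOf R W j i as)
    child   : ∀ j i as a → suc j < h →
              AttachedTo (W (suc j) i (a ∷ as)) (W j i as) (partW j i as) (sel j i as a)

  father : (j : ℕ) → Fin k → Vec (Fin (k ∸ 2)) j → Path G l
  father = fatherOf R W

  level : ℕ → List (Path G l)
  level = levelOf R W

-- The walks form a tree: each meets its father only strictly inside one of the father's
-- subpaths, siblings use distinct subpaths and grandchildren free ones.  From any vertex of a
-- walk one can climb to an ancestor, running along each walk (length at most l) to where it
-- meets its father.  Suppose two walks share a vertex without being father and child.  If they
-- hang below distinct siblings with father A, climbing to both siblings' subpaths of A gives a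
-- walk between two vertices of A that misses an endpoint of a subpath between them.  If one
-- hangs below a grandchild of the other walk Y, going along Y from where the grandchild's father
-- C meets Y and then climbing to C gives such a walk for C.  Either walk has length O(h l), and
-- together with the part of A (or C) it spans it contains a cycle shorter than the girth 10 h l.
module Submission where

open import Defs
open import Data.Empty using (⊥; ⊥-elim)
open import Data.Fin as F using (Fin; toℕ; inject₁; fromℕ)
open import Data.Fin.Properties
  using (toℕ-injective; toℕ-inject₁; toℕ-fromℕ; toℕ-fromℕ<; toℕ<n; toℕ≤pred[n])
open import Data.List
  using (List; []; _∷_; _++_; length; map; concatMap; cartesianProductWith; allFin)
open import Data.List.Membership.Propositional using (_∈_; _∉_)
open import Data.List.Membership.Propositional.Properties using (∈-map⁻)
open import Data.List.Properties using (length-++; length-map; length-tabulate)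
open import Data.List.Relation.Unary.All as All using (All; []; _∷_)
open import Data.List.Relation.Unary.All.Properties using (¬Any⇒All¬)
open import Data.List.Relation.Unary.AllPairs as AllPairs using (AllPairs; []; _∷_)
import Data.List.Relation.Unary.AllPairs.Properties as AllPairsₚ
open import Data.List.Relation.Unary.Any using (here; there)
open import Data.List.Relation.Unary.Unique.Propositional using (Unique)
import Data.List.Relation.Unary.Unique.Propositional.Properties as Unique
open import Data.Nat using (ℕ; zero; suc; _+_; _*_; _∸_; _^_; _≤_; _<_; z≤n; s≤s; NonZero)
open import Data.Nat.Induction using (<-rec)
import Data.Nat.Properties as ℕ
open import Data.Nat.Tactic.RingSolver using (solve-∀)
open import Data.Product using (Σ; ∃-syntax; _×_; _,_; proj₁)
open import Data.Sum using (_⊎_; inj₁; inj₂; swap)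
open import Data.Vec using (Vec; []; _∷_)
import Data.Vec.Properties
open import Function using (id; _∘_)
open import Function.Properties.Equivalence using () renaming (refl to ⇔-refl)
open import Relation.Binary.Definitions using (tri<; tri≈; tri>)
open import Relation.Binary.PropositionalEquality as ≡
  using (_≡_; _≢_; refl; trans; cong; cong₂; subst; subst₂)
open import Relation.Nullary using (¬_; Dec; yes; no)

-- a position given as a number; junk value: numbers beyond m read as m
clamp : ∀ {m} → ℕ → Fin (suc m)
clamp {m} t with t ℕ.≤? m
... | yes t≤m = F.fromℕ< (s≤s t≤m)
... | no _    = fromℕ m

toℕ-clamp : ∀ {m t} → t ≤ m → toℕ (clamp {m} t) ≡ t
toℕ-clamp {m} {t} t≤m with t ℕ.≤? m
... | yes p  = toℕ-fromℕ< (s≤s p)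
... | no t≰m = ⊥-elim (t≰m t≤m)

clamp-toℕ : ∀ {m} (t : Fin (suc m)) → clamp (toℕ t) ≡ t
clamp-toℕ t = toℕ-injective (toℕ-clamp (toℕ≤pred[n] t))

clamp-inject₁ : ∀ {m} (i : Fin m) → clamp (toℕ i) ≡ inject₁ i
clamp-inject₁ i = toℕ-injective (trans (toℕ-clamp (ℕ.<⇒≤ (toℕ<n i))) (≡.sym (toℕ-inject₁ i)))

clamp-suc : ∀ {m} (i : Fin m) → clamp (suc (toℕ i)) ≡ F.suc i
clamp-suc i = toℕ-injective (toℕ-clamp (toℕ<n i))

module Walks {n : ℕ} (G : Graph n) where
  open import Data.List.Membership.DecPropositional (F._≟_ {n}) using (_∈?_)

  Vertex : Set
  Vertex = Fin n

  adj-sym : ∀ {u v} → Adj G u v → Adj G v u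
  adj-sym {u} {v} e = trans (Graph.sym G v u) e

  infixr 5 _∷⟨_⟩_ _++ʷ_

  data Walk : Vertex → Vertex → Set where
    nil    : ∀ x → Walk x x
    _∷⟨_⟩_ : ∀ x {y z} → Adj G x y → Walk y z → Walk x z

  vertices : ∀ {x y} → Walk x y → List Vertex
  vertices (nil x)       = x ∷ []
  vertices (x ∷⟨ _ ⟩ w) = x ∷ vertices w

  -- all vertices but the final one; for a closed walk these are the vertices of the cycle
  initVertices : ∀ {x y} → Walk x y → List Vertex
  initVertices (nil x)       = []
  initVertices (x ∷⟨ _ ⟩ w) = x ∷ initVertices w

  lengthʷ : ∀ {x y} → Walk x y → ℕ
  lengthʷ (nil x)       = 0
  lengthʷ (x ∷⟨ _ ⟩ w) = suc (lengthʷ w)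

  Simple : ∀ {x y} → Walk x y → Set
  Simple w = Unique (vertices w)

  _++ʷ_ : ∀ {x y z} → Walk x y → Walk y z → Walk x z
  nil x        ++ʷ w′ = w′
  (x ∷⟨ e ⟩ w) ++ʷ w′ = x ∷⟨ e ⟩ (w ++ʷ w′)

  reverseʷ : ∀ {x y} → Walk x y → Walk y x
  reverseʷ (nil x)       = nil x
  reverseʷ (x ∷⟨ e ⟩ w) = reverseʷ w ++ʷ (_ ∷⟨ adj-sym e ⟩ nil x)

  castʷ : ∀ {x x′ y y′} → x ≡ x′ → y ≡ y′ → Walk x y → Walk x′ y′
  castʷ refl refl w = w

  lengthʷ-castʷ : ∀ {x x′ y y′} (p : x ≡ x′) (q : y ≡ y′) (w : Walk x y) → lengthʷ (castʷ p q w) ≡ lengthʷ w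
  lengthʷ-castʷ refl refl w = refl

  vertices-castʷ : ∀ {x x′ y y′} (p : x ≡ x′) (q : y ≡ y′) (w : Walk x y) →
                   vertices (castʷ p q w) ≡ vertices w
  vertices-castʷ refl refl w = refl

  lengthʷ-++ʷ : ∀ {x y z} (w : Walk x y) (w′ : Walk y z) → lengthʷ (w ++ʷ w′) ≡ lengthʷ w + lengthʷ w′
  lengthʷ-++ʷ (nil x)       w′ = refl
  lengthʷ-++ʷ (x ∷⟨ e ⟩ w) w′ = cong suc (lengthʷ-++ʷ w w′)

  lengthʷ-reverseʷ : ∀ {x y} (w : Walk x y) → lengthʷ (reverseʷ w) ≡ lengthʷ w
  lengthʷ-reverseʷ (nil x)       = refl
  lengthʷ-reverseʷ (x ∷⟨ e ⟩ w) = trans (lengthʷ-++ʷ (reverseʷ w) _)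
    (trans (ℕ.+-comm (lengthʷ (reverseʷ w)) 1) (cong suc (lengthʷ-reverseʷ w)))

  lengthʷ-prefix : ∀ {x y z} (w : Walk x y) (w′ : Walk y z) → lengthʷ w ≤ lengthʷ (w ++ʷ w′)
  lengthʷ-prefix w w′ = subst (lengthʷ w ≤_) (≡.sym (lengthʷ-++ʷ w w′)) (ℕ.m≤m+n _ _)

  lengthʷ-suffix : ∀ {x y z} (w : Walk x y) (w′ : Walk y z) → lengthʷ w′ ≤ lengthʷ (w ++ʷ w′)
  lengthʷ-suffix w w′ = subst (lengthʷ w′ ≤_) (≡.sym (lengthʷ-++ʷ w w′)) (ℕ.m≤n+m _ _)

  initVertices-++ʷ : ∀ {x y z} (w : Walk x y) (w′ : Walk y z) →
                     initVertices (w ++ʷ w′) ≡ initVertices w ++ initVertices w′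
  initVertices-++ʷ (nil x)       w′ = refl
  initVertices-++ʷ (x ∷⟨ e ⟩ w) w′ = cong (x ∷_) (initVertices-++ʷ w w′)

  start∈ : ∀ {x y} (w : Walk x y) → x ∈ vertices w
  start∈ (nil x)       = here refl
  start∈ (x ∷⟨ e ⟩ w) = here refl

  end∈ : ∀ {x y} (w : Walk x y) → y ∈ vertices w
  end∈ (nil x)       = here refl
  end∈ (x ∷⟨ e ⟩ w) = there (end∈ w)

  initVertices⊆vertices : ∀ {x y v} (w : Walk x y) → v ∈ initVertices w → v ∈ vertices w
  initVertices⊆vertices (x ∷⟨ e ⟩ w) (here p)  = here p
  initVertices⊆vertices (x ∷⟨ e ⟩ w) (there p) = there (initVertices⊆vertices w p)

  ∈-vertices⁻ : ∀ {x y v} (w : Walk x y) → v ∈ vertices w → v ∈ initVertices w ⊎ v ≡ y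
  ∈-vertices⁻ (nil x)       (here p)  = inj₂ p
  ∈-vertices⁻ (x ∷⟨ e ⟩ w) (here p)  = inj₁ (here p)
  ∈-vertices⁻ (x ∷⟨ e ⟩ w) (there p) with ∈-vertices⁻ w p
  ... | inj₁ q = inj₁ (there q)
  ... | inj₂ q = inj₂ q

  ∈-++ʷ⁺ˡ : ∀ {x y z v} (w : Walk x y) (w′ : Walk y z) → v ∈ vertices w → v ∈ vertices (w ++ʷ w′)
  ∈-++ʷ⁺ˡ (nil x)       w′ (here refl) = start∈ w′
  ∈-++ʷ⁺ˡ (x ∷⟨ e ⟩ w) w′ (here p)    = here p
  ∈-++ʷ⁺ˡ (x ∷⟨ e ⟩ w) w′ (there p)   = there (∈-++ʷ⁺ˡ w w′ p)

  ∈-++ʷ⁺ʳ : ∀ {x y z v} (w : Walk x y) (w′ : Walk y z) → v ∈ vertices w′ → v ∈ vertices (w ++ʷ w′)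
  ∈-++ʷ⁺ʳ (nil x)       w′ p = p
  ∈-++ʷ⁺ʳ (x ∷⟨ e ⟩ w) w′ p = there (∈-++ʷ⁺ʳ w w′ p)

  ∈-++ʷ⁻ : ∀ {x y z v} (w : Walk x y) (w′ : Walk y z) →
           v ∈ vertices (w ++ʷ w′) → v ∈ vertices w ⊎ v ∈ vertices w′
  ∈-++ʷ⁻ (nil x)       w′ p         = inj₂ p
  ∈-++ʷ⁻ (x ∷⟨ e ⟩ w) w′ (here p)  = inj₁ (here p)
  ∈-++ʷ⁻ (x ∷⟨ e ⟩ w) w′ (there p) with ∈-++ʷ⁻ w w′ p
  ... | inj₁ q = inj₁ (there q)
  ... | inj₂ q = inj₂ q

  ∈-reverseʷ⁻ : ∀ {x y v} (w : Walk x y) → v ∈ vertices (reverseʷ w) → v ∈ vertices w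
  ∈-reverseʷ⁻ (nil x)       p = p
  ∈-reverseʷ⁻ (x ∷⟨ e ⟩ w) p with ∈-++ʷ⁻ (reverseʷ w) (_ ∷⟨ adj-sym e ⟩ nil x) p
  ... | inj₁ q                 = there (∈-reverseʷ⁻ w q)
  ... | inj₂ (here refl)       = there (start∈ w)
  ... | inj₂ (there (here refl)) = here refl

  split : ∀ {x y v} (w : Walk x y) → v ∈ vertices w →
          Σ (Walk x v) λ w₁ → Σ (Walk v y) λ w₂ → w₁ ++ʷ w₂ ≡ w
  split (nil x)       (here refl) = nil x , nil x , refl
  split (x ∷⟨ e ⟩ w) (here refl) = nil x , x ∷⟨ e ⟩ w , refl
  split (x ∷⟨ e ⟩ w) (there p) with split w p
  ... | w₁ , w₂ , refl = x ∷⟨ e ⟩ w₁ , w₂ , refl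

  Simple-initVertices : ∀ {x y} (w : Walk x y) → Simple w → Unique (initVertices w)
  Simple-initVertices (nil x)       _         = []
  Simple-initVertices (x ∷⟨ e ⟩ w) (x∉ ∷ sw) =
    All.tabulate (λ m → All.lookup x∉ (initVertices⊆vertices w m)) ∷ Simple-initVertices w sw

  Simple⇒end∉initVertices : ∀ {x y} (w : Walk x y) → Simple w → y ∉ initVertices w
  Simple⇒end∉initVertices (x ∷⟨ e ⟩ w) (x∉ ∷ sw) (here refl) = All.lookup x∉ (end∈ w) refl
  Simple⇒end∉initVertices (x ∷⟨ e ⟩ w) (x∉ ∷ sw) (there m)   = Simple⇒end∉initVertices w sw m

  Simple-prefix : ∀ {x y z} (w : Walk x y) (w′ : Walk y z) → Simple (w ++ʷ w′) → Simple w
  Simple-prefix (nil x)       w′ _         = [] ∷ []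
  Simple-prefix (x ∷⟨ e ⟩ w) w′ (x∉ ∷ sw) =
    All.tabulate (λ m → All.lookup x∉ (∈-++ʷ⁺ˡ w w′ m)) ∷ Simple-prefix w w′ sw

  Simple-suffix : ∀ {x y z} (w : Walk x y) (w′ : Walk y z) → Simple (w ++ʷ w′) → Simple w′
  Simple-suffix (nil x)       w′ sw       = sw
  Simple-suffix (x ∷⟨ e ⟩ w) w′ (_ ∷ sw) = Simple-suffix w w′ sw

  Simple-extend : ∀ {x y z} (w : Walk x y) (e : Adj G y z) → Simple w → z ∉ vertices w →
                  Simple (w ++ʷ (y ∷⟨ e ⟩ nil z))
  Simple-extend (nil x)       e _          z∉ =
    All.tabulate (λ { (here refl) refl → z∉ (here refl) }) ∷ [] ∷ []
  Simple-extend (x ∷⟨ e′ ⟩ w) e (x∉ ∷ sw) z∉ =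
    All.tabulate x≢ ∷ Simple-extend w e sw (λ m → z∉ (there m))
    where
    x≢ : ∀ {v} → v ∈ vertices (w ++ʷ (_ ∷⟨ e ⟩ nil _)) → x ≢ v
    x≢ m refl with ∈-++ʷ⁻ w _ m
    ... | inj₁ x∈w                = All.lookup x∉ x∈w refl
    ... | inj₂ (here refl)        = All.lookup x∉ (end∈ w) refl
    ... | inj₂ (there (here refl)) = z∉ (here refl)

  Simple⇒ends≢ : ∀ {x y} (w : Walk x y) → Simple w → 1 ≤ lengthʷ w → x ≢ y
  Simple⇒ends≢ (x ∷⟨ e ⟩ w) (x∉ ∷ _) _ refl = All.lookup x∉ (end∈ w) refl

  lengthʷ≡0⇒ends≡ : ∀ {x y} (w : Walk x y) → lengthʷ w ≡ 0 → x ≡ y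
  lengthʷ≡0⇒ends≡ (nil x) _ = refl

  eraseLoops : ∀ {x y} (w : Walk x y) →
               Σ (Walk x y) λ s → Simple s × (∀ {v} → v ∈ vertices s → v ∈ vertices w) × lengthʷ s ≤ lengthʷ w
  eraseLoops (nil x) = nil x , [] ∷ [] , (λ m → m) , z≤n
  eraseLoops (x ∷⟨ e ⟩ w) with eraseLoops w
  ... | s , simple , sub , short with x ∈? vertices s
  ...   | yes x∈s with split s x∈s
  ...     | s₁ , s₂ , refl =
            s₂ , Simple-suffix s₁ s₂ simple , (λ m → there (sub (∈-++ʷ⁺ʳ s₁ s₂ m)))
            , ℕ.m≤n⇒m≤1+n (ℕ.≤-trans (lengthʷ-suffix s₁ s₂) short)
  eraseLoops (x ∷⟨ e ⟩ w) | s , simple , sub , short | no x∉s =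
    x ∷⟨ e ⟩ s , ¬Any⇒All¬ (vertices s) x∉s ∷ simple , sub′ , s≤s short
    where
    sub′ : ∀ {v} → v ∈ vertices (x ∷⟨ e ⟩ s) → v ∈ vertices (x ∷⟨ e ⟩ w)
    sub′ (here p)  = here p
    sub′ (there p) = there (sub p)

  vertexAt : ∀ {x y} → Walk x y → ℕ → Vertex
  vertexAt (nil x)       _       = x
  vertexAt (x ∷⟨ e ⟩ w) zero    = x
  vertexAt (x ∷⟨ e ⟩ w) (suc t) = vertexAt w t

  vertexAt-start : ∀ {x y} (w : Walk x y) → vertexAt w 0 ≡ x
  vertexAt-start (nil x)       = refl
  vertexAt-start (x ∷⟨ e ⟩ w) = refl

  vertexAt-end : ∀ {x y} (w : Walk x y) → vertexAt w (lengthʷ w) ≡ y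
  vertexAt-end (nil x)       = refl
  vertexAt-end (x ∷⟨ e ⟩ w) = vertexAt-end w

  vertexAt-adjacent : ∀ {x y} (w : Walk x y) t → t < lengthʷ w → Adj G (vertexAt w t) (vertexAt w (suc t))
  vertexAt-adjacent (x ∷⟨ e ⟩ w) zero    _       = subst (Adj G x) (≡.sym (vertexAt-start w)) e
  vertexAt-adjacent (x ∷⟨ e ⟩ w) (suc t) (s≤s p) = vertexAt-adjacent w t p

  vertexAt∈initVertices : ∀ {x y} (w : Walk x y) t → t < lengthʷ w → vertexAt w t ∈ initVertices w
  vertexAt∈initVertices (x ∷⟨ e ⟩ w) zero    _       = here refl
  vertexAt∈initVertices (x ∷⟨ e ⟩ w) (suc t) (s≤s p) = there (vertexAt∈initVertices w t p)

  vertexAt-injective : ∀ {x y} (w : Walk x y) → Unique (initVertices w) →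
                       ∀ s t → s < lengthʷ w → t < lengthʷ w → vertexAt w s ≡ vertexAt w t → s ≡ t
  vertexAt-injective (x ∷⟨ e ⟩ w) _ zero zero _ _ _ = refl
  vertexAt-injective (x ∷⟨ e ⟩ w) (x∉ ∷ _) zero (suc t) _ (s≤s q) eq =
    ⊥-elim (All.lookup x∉ (vertexAt∈initVertices w t q) eq)
  vertexAt-injective (x ∷⟨ e ⟩ w) (x∉ ∷ _) (suc s) zero (s≤s p) _ eq =
    ⊥-elim (All.lookup x∉ (vertexAt∈initVertices w s p) (≡.sym eq))
  vertexAt-injective (x ∷⟨ e ⟩ w) (_ ∷ u) (suc s) (suc t) (s≤s p) (s≤s q) eq =
    cong suc (vertexAt-injective w u s t p q eq)

  closedWalk⇒Cycle : ∀ {x} (c : Walk x x) → Unique (initVertices c) → 3 ≤ lengthʷ c → Cycle G (lengthʷ c)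
  closedWalk⇒Cycle {x} c u long = record
    { cv     = λ i → vertexAt c (toℕ i)
    ; cstep  = λ i → subst (λ t → Adj G (vertexAt c t) (vertexAt c (suc (toℕ i))))
                           (≡.sym (toℕ-inject₁ i)) (vertexAt-adjacent c (toℕ i) (toℕ<n i))
    ; closed = trans (vertexAt-start c)
                 (≡.sym (trans (cong (vertexAt c) (toℕ-fromℕ (lengthʷ c))) (vertexAt-end c)))
    ; cinj   = λ {i} {j} eq → toℕ-injective
                 (vertexAt-injective c u (toℕ i) (toℕ j) (toℕ<n i) (toℕ<n j)
                   (trans (cong (vertexAt c) (≡.sym (toℕ-inject₁ i)))
                     (trans eq (cong (vertexAt c) (toℕ-inject₁ j)))))
    ; clen   = long }

  CycleOfLengthAtMost : ℕ → Set
  CycleOfLengthAtMost b = ∃[ m ] Cycle G m × m ≤ b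

  internallyDisjoint⇒cycle : ∀ {x y} (s : Walk x y) → Simple s → 2 ≤ lengthʷ s → (w : Walk x y) →
    (∀ {v} → v ∈ vertices s → v ≢ x → v ≢ y → v ∉ vertices w) →
    CycleOfLengthAtMost (lengthʷ s + lengthʷ w)
  internallyDisjoint⇒cycle {x} {y} s simple long w avoids with eraseLoops (reverseʷ w)
  ... | q , simple-q , q⊆ , short = lengthʷ (s ++ʷ q) , closedWalk⇒Cycle (s ++ʷ q) unique long′ , bound
    where
    q⊆w : ∀ {v} → v ∈ initVertices q → v ∈ vertices w
    q⊆w m = ∈-reverseʷ⁻ w (q⊆ (initVertices⊆vertices q m))
    disjoint : ∀ {v} → v ∈ initVertices s × v ∈ initVertices q → ⊥
    disjoint {v} (vs , vq) with v F.≟ x | v F.≟ y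
    ... | yes refl | _        = Simple⇒end∉initVertices q simple-q vq
    ... | no _     | yes refl = Simple⇒end∉initVertices s simple vs
    ... | no v≢x   | no v≢y   = avoids (initVertices⊆vertices s vs) v≢x v≢y (q⊆w vq)
    unique : Unique (initVertices (s ++ʷ q))
    unique = subst Unique (≡.sym (initVertices-++ʷ s q))
      (Unique.++⁺ (Simple-initVertices s simple) (Simple-initVertices q simple-q) disjoint)
    q-nonempty : 1 ≤ lengthʷ q
    q-nonempty with lengthʷ q in eq
    ... | zero  = ⊥-elim (Simple⇒ends≢ s simple (ℕ.≤-trans (s≤s z≤n) long)
                          (≡.sym (lengthʷ≡0⇒ends≡ q eq)))
    ... | suc _ = s≤s z≤n
    long′ : 3 ≤ lengthʷ (s ++ʷ q)
    long′ = subst (3 ≤_) (≡.sym (lengthʷ-++ʷ s q)) (ℕ.+-mono-≤ long q-nonempty)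
    bound : lengthʷ (s ++ʷ q) ≤ lengthʷ s + lengthʷ w
    bound = subst (_≤ lengthʷ s + lengthʷ w) (≡.sym (lengthʷ-++ʷ s q))
      (ℕ.+-monoʳ-≤ (lengthʷ s) (subst (lengthʷ q ≤_) (lengthʷ-reverseʷ w) short))

  splitAtFirstHit : ∀ {x y} (p : Walk x y) (vs : List Vertex) → y ∈ vs →
    ∃[ b ] Σ (Walk x b) λ s → Σ (Walk b y) λ r →
      s ++ʷ r ≡ p × b ∈ vs × (∀ {v} → v ∈ initVertices s → v ∉ vs)
  splitAtFirstHit (nil x) vs y∈vs = x , nil x , nil x , refl , y∈vs , λ ()
  splitAtFirstHit (x ∷⟨ e ⟩ p) vs y∈vs with x ∈? vs
  ... | yes x∈vs = x , nil x , x ∷⟨ e ⟩ p , refl , x∈vs , λ ()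
  ... | no x∉vs with splitAtFirstHit p vs y∈vs
  ...   | b , s , r , refl , b∈vs , s∉vs = b , x ∷⟨ e ⟩ s , r , refl , b∈vs , s∉vs′
    where
    s∉vs′ : ∀ {v} → v ∈ initVertices (x ∷⟨ e ⟩ s) → v ∉ vs
    s∉vs′ (here refl) = x∉vs
    s∉vs′ (there m)   = s∉vs m

  -- If the second vertex of p lies on w, start again from there.  Otherwise p leaves w at x; its
  -- piece up to the next vertex b on w and the part of w from x to b are internally disjoint.
  avoidingWalk⇒cycle : ∀ {x y u} (p : Walk x y) → Simple p → u ∈ vertices p →
    (w : Walk x y) → u ∉ vertices w → CycleOfLengthAtMost (lengthʷ p + lengthʷ w)
  avoidingWalk⇒cycle (nil x)       _ (here refl) w u∉w = ⊥-elim (u∉w (start∈ w))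
  avoidingWalk⇒cycle (x ∷⟨ e ⟩ p) _ (here refl) w u∉w = ⊥-elim (u∉w (start∈ w))
  avoidingWalk⇒cycle (_∷⟨_⟩_ x {x₁} e p) (_ ∷ simple) (there u∈p) w u∉w with x₁ ∈? vertices w
  ... | yes x₁∈w with split w x₁∈w
  ...   | w₁ , w₂ , refl with avoidingWalk⇒cycle p simple u∈p w₂ (λ m → u∉w (∈-++ʷ⁺ʳ w₁ w₂ m))
  ...     | m , cycle , bound = m , cycle ,
            ℕ.≤-trans bound (ℕ.+-mono-≤ (ℕ.n≤1+n (lengthʷ p)) (lengthʷ-suffix w₁ w₂))
  avoidingWalk⇒cycle (_∷⟨_⟩_ x {x₁} e p) (x∉ ∷ simple) (there u∈p) w u∉w | no x₁∉w
    with splitAtFirstHit p (vertices w) (end∈ w)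
  ... | b , s , r , refl , b∈w , s∉w with split w b∈w
  ...   | w₁ , w₂ , refl with internallyDisjoint⇒cycle (x ∷⟨ e ⟩ s) simple-s long w₁ avoids
    where
    simple-s : Simple (x ∷⟨ e ⟩ s)
    simple-s = Simple-prefix (x ∷⟨ e ⟩ s) r (x∉ ∷ simple)
    long : 2 ≤ lengthʷ (x ∷⟨ e ⟩ s)
    long with lengthʷ s in eq
    ... | zero  = ⊥-elim (x₁∉w (subst (_∈ vertices (w₁ ++ʷ w₂)) (≡.sym (lengthʷ≡0⇒ends≡ s eq)) b∈w))
    ... | suc _ = s≤s (s≤s z≤n)
    avoids : ∀ {v} → v ∈ vertices (x ∷⟨ e ⟩ s) → v ≢ x → v ≢ b → v ∉ vertices w₁
    avoids (here refl) v≢x _ _ = v≢x refl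
    avoids (there v∈s) _ v≢b v∈w₁ with ∈-vertices⁻ s v∈s
    ... | inj₁ v∈init = s∉w v∈init (∈-++ʷ⁺ˡ w₁ w₂ v∈w₁)
    ... | inj₂ v≡b    = v≢b v≡b
  ...     | m , cycle , bound = m , cycle ,
            ℕ.≤-trans bound (ℕ.+-mono-≤ (s≤s (lengthʷ-prefix s r)) (lengthʷ-prefix w₁ w₂))

girth-forbids : ∀ {n} {G : Graph n} {h l b} c → 1 ≤ h → GirthAtLeast G (10 * h * l) →
                Walks.CycleOfLengthAtMost G b → b ≤ c * l → c ≤ suc (h + h) → ⊥
girth-forbids {l = zero} c _ _ (m , cycle , m≤b) b≤ _ =
  ℕ.<⇒≱ (Cycle.clen cycle) (ℕ.≤-trans m≤b (ℕ.≤-trans b≤ (ℕ.≤-trans (ℕ.≤-reflexive (ℕ.*-zeroʳ c)) z≤n)))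
girth-forbids {l = suc l} c 1≤h girth (m , cycle , m≤b) b≤ c≤ =
  ℕ.<-irrefl refl (ℕ.≤-<-trans (girth m cycle)
    (ℕ.≤-<-trans (ℕ.≤-trans m≤b b≤) (ℕ.*-monoˡ-< (suc l) (ℕ.≤-<-trans c≤ (2h+1<10h 1≤h)))))
  where
  2h+1<10h : ∀ {g} → 1 ≤ g → suc (g + g) < 10 * g
  2h+1<10h {suc g} _ = subst (3 + (g + suc g) ≤_) (identity g) (ℕ.m≤m+n _ (6 + 8 * g))
    where
    identity : ∀ g → 3 + (g + suc g) + (6 + 8 * g) ≡ 10 * suc g
    identity = solve-∀

Between : ℕ → ℕ → ℕ → Set
Between a b c = (a < b × b < c) ⊎ (c < b × b < a)

module PathWalks {n : ℕ} (G : Graph n) (l : ℕ) where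
  open Walks G

  at : Path G l → ℕ → Vertex
  at W t = vert W (clamp t)

  at-toℕ : (W : Path G l) (t : Fin (suc l)) → at W (toℕ t) ≡ vert W t
  at-toℕ W t = cong (vert W) (clamp-toℕ t)

  at-injective : (W : Path G l) {s t : ℕ} → s ≤ l → t ≤ l → at W s ≡ at W t → s ≡ t
  at-injective W s≤l t≤l eq = trans (≡.sym (toℕ-clamp s≤l)) (trans (cong toℕ (inj W eq)) (toℕ-clamp t≤l))

  at-adjacent : (W : Path G l) (t : ℕ) → t < l → Adj G (at W t) (at W (suc t))
  at-adjacent W t t<l = subst₂ (λ u v → Adj G (at W u) (at W v)) (toℕ-fromℕ< t<l) (cong suc (toℕ-fromℕ< t<l))
    (subst₂ (λ u v → Adj G (vert W u) (vert W v)) (≡.sym (clamp-inject₁ i)) (≡.sym (clamp-suc i)) (step W i))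
    where i = F.fromℕ< t<l

  along : (W : Path G l) {s t : ℕ} → s ≤ t → t ≤ l → Walk (at W s) (at W t)
  along W {s} s≤t t≤l with ℕ.m≤n⇒m<n∨m≡n s≤t
  ... | inj₂ refl               = nil (at W s)
  ... | inj₁ (s≤s {n = t′} s≤t′) = along W s≤t′ (ℕ.<⇒≤ t≤l) ++ʷ (at W t′ ∷⟨ at-adjacent W t′ t≤l ⟩ nil _)

  lengthʷ-along : (W : Path G l) {s t : ℕ} (s≤t : s ≤ t) (t≤l : t ≤ l) → lengthʷ (along W s≤t t≤l) ≤ t
  lengthʷ-along W s≤t t≤l with ℕ.m≤n⇒m<n∨m≡n s≤t
  ... | inj₂ refl               = z≤n
  ... | inj₁ (s≤s {n = t′} s≤t′) =
    subst (_≤ suc t′) (≡.sym (trans (lengthʷ-++ʷ (along W s≤t′ _) _) (ℕ.+-comm _ 1)))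
      (s≤s (lengthʷ-along W s≤t′ (ℕ.<⇒≤ t≤l)))

  ∈-along⁻ : (W : Path G l) {s t : ℕ} (s≤t : s ≤ t) (t≤l : t ≤ l) {v : Vertex} →
             v ∈ vertices (along W s≤t t≤l) → ∃[ u ] s ≤ u × u ≤ t × v ≡ at W u
  ∈-along⁻ W {s} s≤t t≤l v∈ with ℕ.m≤n⇒m<n∨m≡n s≤t | v∈
  ... | inj₂ refl | here refl = s , ℕ.≤-refl , ℕ.≤-refl , refl
  ... | inj₁ (s≤s {n = t′} s≤t′) | v∈′ with ∈-++ʷ⁻ (along W s≤t′ (ℕ.<⇒≤ t≤l)) _ v∈′
  ...   | inj₂ (here refl)         = t′ , s≤t′ , ℕ.n≤1+n t′ , refl
  ...   | inj₂ (there (here refl)) = suc t′ , ℕ.m≤n⇒m≤1+n s≤t′ , ℕ.≤-refl , refl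
  ...   | inj₁ v∈″ with ∈-along⁻ W s≤t′ (ℕ.<⇒≤ t≤l) v∈″
  ...     | u , s≤u , u≤t′ , eq = u , s≤u , ℕ.m≤n⇒m≤1+n u≤t′ , eq

  ∈-along⁺ : (W : Path G l) {s t : ℕ} (s≤t : s ≤ t) (t≤l : t ≤ l) (u : ℕ) → s ≤ u → u ≤ t →
             at W u ∈ vertices (along W s≤t t≤l)
  ∈-along⁺ W s≤t t≤l u s≤u u≤t with ℕ.m≤n⇒m<n∨m≡n s≤t
  ... | inj₂ refl with ℕ.≤-antisym s≤u u≤t
  ...   | refl = here refl
  ∈-along⁺ W s≤t t≤l u s≤u u≤t | inj₁ (s≤s {n = t′} s≤t′) with u ℕ.≤? t′
  ... | yes u≤t′ = ∈-++ʷ⁺ˡ (along W s≤t′ (ℕ.<⇒≤ t≤l)) _ (∈-along⁺ W s≤t′ (ℕ.<⇒≤ t≤l) u s≤u u≤t′)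
  ... | no u≰t′ with ℕ.≤-antisym u≤t (ℕ.≰⇒> u≰t′)
  ...   | refl = ∈-++ʷ⁺ʳ (along W s≤t′ (ℕ.<⇒≤ t≤l)) _ (there (here refl))

  Simple-along : (W : Path G l) {s t : ℕ} (s≤t : s ≤ t) (t≤l : t ≤ l) → Simple (along W s≤t t≤l)
  Simple-along W s≤t t≤l with ℕ.m≤n⇒m<n∨m≡n s≤t
  ... | inj₂ refl               = [] ∷ []
  ... | inj₁ (s≤s {n = t′} s≤t′) = Simple-extend (along W s≤t′ _) _ (Simple-along W s≤t′ _) new∉
    where
    new∉ : at W (suc t′) ∉ vertices (along W s≤t′ (ℕ.<⇒≤ t≤l))
    new∉ v∈ with ∈-along⁻ W s≤t′ (ℕ.<⇒≤ t≤l) v∈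
    ... | u , _ , u≤t′ , eq = ℕ.<⇒≢ (s≤s u≤t′) (≡.sym (at-injective W t≤l (ℕ.≤-trans u≤t′ (ℕ.<⇒≤ t≤l)) eq))

  segment : (W : Path G l) (s t : Fin (suc l)) → toℕ s ≤ toℕ t → Walk (vert W s) (vert W t)
  segment W s t s≤t = castʷ (at-toℕ W s) (at-toℕ W t) (along W s≤t (toℕ≤pred[n] t))

  vertices-segment : (W : Path G l) (s t : Fin (suc l)) (s≤t : toℕ s ≤ toℕ t) →
                     vertices (segment W s t s≤t) ≡ vertices (along W s≤t (toℕ≤pred[n] t))
  vertices-segment W s t s≤t = vertices-castʷ _ _ (along W s≤t (toℕ≤pred[n] t))

  lengthʷ-segment : (W : Path G l) (s t : Fin (suc l)) (s≤t : toℕ s ≤ toℕ t) → lengthʷ (segment W s t s≤t) ≤ l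
  lengthʷ-segment W s t s≤t = subst (_≤ l) (≡.sym (lengthʷ-castʷ _ _ (along W s≤t (toℕ≤pred[n] t))))
    (ℕ.≤-trans (lengthʷ-along W s≤t _) (toℕ≤pred[n] t))

  Simple-segment : (W : Path G l) (s t : Fin (suc l)) (s≤t : toℕ s ≤ toℕ t) → Simple (segment W s t s≤t)
  Simple-segment W s t s≤t = subst Unique (≡.sym (vertices-segment W s t s≤t)) (Simple-along W s≤t _)

  ∈-segment⁺ : (W : Path G l) (s t : Fin (suc l)) (s≤t : toℕ s ≤ toℕ t) (u : Fin (suc l)) →
               toℕ s ≤ toℕ u → toℕ u ≤ toℕ t → vert W u ∈ vertices (segment W s t s≤t)
  ∈-segment⁺ W s t s≤t u s≤u u≤t = subst (vert W u ∈_) (≡.sym (vertices-segment W s t s≤t))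
    (subst (_∈ vertices (along W s≤t _)) (at-toℕ W u) (∈-along⁺ W s≤t _ (toℕ u) s≤u u≤t))

  ∈-segment⁻ : (W : Path G l) (s t : Fin (suc l)) (s≤t : toℕ s ≤ toℕ t) {v : Vertex} →
               v ∈ vertices (segment W s t s≤t) → v ∈P W
  ∈-segment⁻ W s t s≤t {v} v∈ with ∈-along⁻ W s≤t _ (subst (v ∈_) (vertices-segment W s t s≤t) v∈)
  ... | u , _ , _ , eq = clamp u , ≡.sym eq

  private
    segment↔ : (W : Path G l) (s t : Fin (suc l)) → Walk (vert W s) (vert W t)
    segment↔ W s t with toℕ s ℕ.≤? toℕ t
    ... | yes s≤t = segment W s t s≤t
    ... | no s≰t  = reverseʷ (segment W t s (ℕ.<⇒≤ (ℕ.≰⇒> s≰t)))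

  route : (W : Path G l) (s t : Fin (suc l)) {x y : Vertex} → vert W s ≡ x → vert W t ≡ y → Walk x y
  route W s t p q = castʷ p q (segment↔ W s t)

  lengthʷ-route : (W : Path G l) (s t : Fin (suc l)) {x y : Vertex} (p : vert W s ≡ x) (q : vert W t ≡ y) →
                  lengthʷ (route W s t p q) ≤ l
  lengthʷ-route W s t p q = subst (_≤ l) (≡.sym (lengthʷ-castʷ p q (segment↔ W s t))) bound
    where
    bound : lengthʷ (segment↔ W s t) ≤ l
    bound with toℕ s ℕ.≤? toℕ t
    ... | yes s≤t = lengthʷ-segment W s t s≤t
    ... | no _    = subst (_≤ l) (≡.sym (lengthʷ-reverseʷ _)) (lengthʷ-segment W t s _)

  ∈-route⁻ : (W : Path G l) (s t : Fin (suc l)) {x y : Vertex} (p : vert W s ≡ x) (q : vert W t ≡ y)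
             {v : Vertex} →
             v ∈ vertices (route W s t p q) → v ∈P W
  ∈-route⁻ W s t p q v∈ = on-W (subst (_ ∈_) (vertices-castʷ p q (segment↔ W s t)) v∈)
    where
    on-W : ∀ {v} → v ∈ vertices (segment↔ W s t) → v ∈P W
    on-W v∈ with toℕ s ℕ.≤? toℕ t
    ... | yes s≤t = ∈-segment⁻ W s t s≤t v∈
    ... | no _    = ∈-segment⁻ W t s _ (∈-reverseʷ⁻ _ v∈)

  detour⇒cycle : (W : Path G l) (s m t : Fin (suc l)) → Between (toℕ s) (toℕ m) (toℕ t) →
                 (w : Walk (vert W s) (vert W t)) → vert W m ∉ vertices w →
                 CycleOfLengthAtMost (l + lengthʷ w)
  detour⇒cycle W s m t (inj₁ (s<m , m<t)) w m∉w
    with avoidingWalk⇒cycle (segment W s t s≤t) (Simple-segment W s t s≤t)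
           (∈-segment⁺ W s t s≤t m (ℕ.<⇒≤ s<m) (ℕ.<⇒≤ m<t)) w m∉w
    where s≤t = ℕ.<⇒≤ (ℕ.<-trans s<m m<t)
  ... | c , cycle , bound = c , cycle , ℕ.≤-trans bound (ℕ.+-monoˡ-≤ _ (lengthʷ-segment W s t _))
  detour⇒cycle W s m t (inj₂ t<m<s) w m∉w
    with detour⇒cycle W t m s (inj₁ t<m<s) (reverseʷ w) (λ m∈ → m∉w (∈-reverseʷ⁻ w m∈))
  ... | c , cycle , bound = c , cycle , subst (λ b → c ≤ l + b) (lengthʷ-reverseʷ w) bound

module _ {l k : ℕ} {{_ : NonZero k}} (P : Partition l k) where

  Within : Fin k → ℕ → Set
  Within s t = pos P (inject₁ s) ≤ t × t ≤ pos P (F.suc s)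

  Inside : Fin k → ℕ → Set
  Inside s t = pos P (inject₁ s) < t × t < pos P (F.suc s)

  private
    boundary : ℕ → ℕ
    boundary m = pos P (clamp m)

    boundary-mono : ∀ {m m′} → m ≤ m′ → m′ ≤ k → boundary m ≤ boundary m′
    boundary-mono {m} {zero}   z≤n _   = ℕ.≤-refl
    boundary-mono {m} {suc m′} m≤ m′<k with ℕ.m≤n⇒m<n∨m≡n m≤
    ... | inj₂ refl     = ℕ.≤-refl
    ... | inj₁ (s≤s m≤′) = ℕ.≤-trans (boundary-mono m≤′ (ℕ.<⇒≤ m′<k)) (boundary-step m′<k)
      where
      boundary-step : ∀ {m} → m < k → boundary m ≤ boundary (suc m)
      boundary-step m<k =
        subst₂ (λ u v → boundary u ≤ boundary v) (toℕ-fromℕ< m<k) (cong suc (toℕ-fromℕ< m<k))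
        (subst₂ (λ u v → pos P u ≤ pos P v) (≡.sym (clamp-inject₁ i)) (≡.sym (clamp-suc i)) (mono P i))
        where i = F.fromℕ< m<k

  slot-end≤slot-start : ∀ {i j : Fin k} → toℕ i < toℕ j → pos P (F.suc i) ≤ pos P (inject₁ j)
  slot-end≤slot-start {i} {j} i<j = subst₂ (λ u v → pos P u ≤ pos P v) (clamp-suc i) (clamp-inject₁ j)
    (boundary-mono i<j (ℕ.<⇒≤ (toℕ<n j)))

  private
    Between⇒≤ : ∀ {m} (t t′ : Fin (suc l)) → Between (toℕ t) m (toℕ t′) → m ≤ l
    Between⇒≤ t t′ (inj₁ (_ , m<t′)) = ℕ.<⇒≤ (ℕ.<-≤-trans m<t′ (toℕ≤pred[n] t′))
    Between⇒≤ t t′ (inj₂ (_ , m<t))  = ℕ.<⇒≤ (ℕ.<-≤-trans m<t (toℕ≤pred[n] t))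

    asPosition : (Q : ℕ → Set) (t t′ : Fin (suc l)) → ∃[ m ] Between (toℕ t) m (toℕ t′) × Q m →
                 ∃[ m ] Between (toℕ t) (toℕ m) (toℕ t′) × Q (toℕ m)
    asPosition Q t t′ (m , between , q) =
      clamp m , subst (λ u → Between (toℕ t) u (toℕ t′) × Q u) (≡.sym (toℕ-clamp (Between⇒≤ t t′ between)))
                  (between , q)

    endpointℕ-between-outside-inside : (t t′ : Fin (suc l)) {s : Fin k} →
      ¬ Within s (toℕ t) → Inside s (toℕ t′) →
      ∃[ m ] Between (toℕ t) m (toℕ t′) × Within s m × ¬ Inside s m
    endpointℕ-between-outside-inside t t′ {s} t∉ (u₀<t′ , t′<u₁) with toℕ t ℕ.<? pos P (inject₁ s)
    ... | yes t<u₀ = _ , inj₁ (t<u₀ , u₀<t′) , (ℕ.≤-refl , ℕ.<⇒≤ (ℕ.<-trans u₀<t′ t′<u₁))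
                       , λ (u₀<u₀ , _) → ℕ.<-irrefl refl u₀<u₀
    ... | no t≮u₀  = _ , inj₂ (t′<u₁ , u₁<t) , (ℕ.<⇒≤ (ℕ.<-trans u₀<t′ t′<u₁) , ℕ.≤-refl)
                       , λ (_ , u₁<u₁) → ℕ.<-irrefl refl u₁<u₁
      where
      u₁<t : pos P (F.suc s) < toℕ t
      u₁<t = ℕ.≰⇒> (λ t≤u₁ → t∉ (ℕ.≮⇒≥ t≮u₀ , t≤u₁))

    endpointℕ-between-ordered-slots : (t₁ t₂ : Fin (suc l)) {s₁ s₂ : Fin k} → toℕ s₁ < toℕ s₂ →
      Inside s₁ (toℕ t₁) → Inside s₂ (toℕ t₂) →
      ∃[ m ] Between (toℕ t₁) m (toℕ t₂) × ¬ Inside s₁ m × ¬ Inside s₂ m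
    endpointℕ-between-ordered-slots t₁ t₂ s₁<s₂ (_ , t₁<u) (v<t₂ , _) =
      _ , inj₁ (t₁<u , ℕ.≤-<-trans u≤v v<t₂)
        , (λ (_ , u<u) → ℕ.<-irrefl refl u<u) , (λ (v<u , _) → ℕ.<⇒≱ v<u u≤v)
      where u≤v = slot-end≤slot-start s₁<s₂

    endpointℕ-between-slots : (t₁ t₂ : Fin (suc l)) {s₁ s₂ : Fin k} → s₁ ≢ s₂ →
      Inside s₁ (toℕ t₁) → Inside s₂ (toℕ t₂) →
      ∃[ m ] Between (toℕ t₁) m (toℕ t₂) × ¬ Inside s₁ m × ¬ Inside s₂ m
    endpointℕ-between-slots t₁ t₂ {s₁} {s₂} s₁≢s₂ t₁∈ t₂∈ with ℕ.<-cmp (toℕ s₁) (toℕ s₂)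
    ... | tri< s₁<s₂ _ _ = endpointℕ-between-ordered-slots t₁ t₂ s₁<s₂ t₁∈ t₂∈
    ... | tri≈ _ s₁≡s₂ _ = ⊥-elim (s₁≢s₂ (toℕ-injective s₁≡s₂))
    ... | tri> _ _ s₂<s₁ with endpointℕ-between-ordered-slots t₂ t₁ s₂<s₁ t₂∈ t₁∈
    ...   | m , between , m∉₂ , m∉₁ = m , swap between , m∉₁ , m∉₂

  endpoint-between-outside-inside : (t t′ : Fin (suc l)) {s : Fin k} →
    ¬ Within s (toℕ t) → Inside s (toℕ t′) →
    ∃[ m ] Between (toℕ t) (toℕ m) (toℕ t′) × Within s (toℕ m) × ¬ Inside s (toℕ m)
  endpoint-between-outside-inside t t′ {s} t∉ t′∈ =
    asPosition (λ m → Within s m × ¬ Inside s m) t t′ (endpointℕ-between-outside-inside t t′ t∉ t′∈)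

  endpoint-between-slots : (t₁ t₂ : Fin (suc l)) {s₁ s₂ : Fin k} → s₁ ≢ s₂ →
    Inside s₁ (toℕ t₁) → Inside s₂ (toℕ t₂) →
    ∃[ m ] Between (toℕ t₁) (toℕ m) (toℕ t₂) × ¬ Inside s₁ (toℕ m) × ¬ Inside s₂ (toℕ m)
  endpoint-between-slots t₁ t₂ {s₁} {s₂} s₁≢s₂ t₁∈ t₂∈ =
    asPosition (λ m → ¬ Inside s₁ m × ¬ Inside s₂ m) t₁ t₂ (endpointℕ-between-slots t₁ t₂ s₁≢s₂ t₁∈ t₂∈)

length-cartesianProductWith : ∀ {A B C : Set} (f : A → B → C) (xs : List A) (ys : List B) →
  length (cartesianProductWith f xs ys) ≡ length xs * length ys
length-cartesianProductWith f []       ys = refl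
length-cartesianProductWith f (x ∷ xs) ys =
  trans (length-++ (map (f x) ys)) (cong₂ _+_ (length-map (f x) ys) (length-cartesianProductWith f xs ys))

concatMap-map : ∀ {A B C : Set} (f : A → B → C) (xs : List A) (ys : List B) →
  concatMap (λ x → map (f x) ys) xs ≡ cartesianProductWith f xs ys
concatMap-map f []       ys = refl
concatMap-map f (x ∷ xs) ys = cong (map (f x) ys ++_) (concatMap-map f xs ys)

module AddressTree (k : ℕ) where

  extend : ∀ {j} → Addr k j → Fin (k ∸ 2) → Addr k (suc j)
  extend (i , as) a = i , a ∷ as

  addrs-suc : ∀ j → addrs k (suc j) ≡ cartesianProductWith extend (addrs k j) (allFin (k ∸ 2))
  addrs-suc j = concatMap-map extend (addrs k j) (allFin (k ∸ 2))

  length-addrs : ∀ j → length (addrs k j) ≡ k * (k ∸ 2) ^ j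
  length-addrs zero = trans (length-map _ (allFin k)) (trans (length-tabulate id) (≡.sym (ℕ.*-identityʳ k)))
  length-addrs (suc j) = begin
    length (addrs k (suc j))                      ≡⟨ cong length (addrs-suc j) ⟩
    length (cartesianProductWith extend (addrs k j) (allFin (k ∸ 2)))
                                                  ≡⟨ length-cartesianProductWith extend (addrs k j) _ ⟩
    length (addrs k j) * length (allFin (k ∸ 2))  ≡⟨ cong₂ _*_ (length-addrs j) (length-tabulate id) ⟩
    k * (k ∸ 2) ^ j * (k ∸ 2)                     ≡⟨ ℕ.*-assoc k _ _ ⟩
    k * ((k ∸ 2) ^ j * (k ∸ 2))                   ≡⟨ cong (k *_) (ℕ.*-comm _ (k ∸ 2)) ⟩
    k * (k ∸ 2) ^ suc j                           ∎
    where open ≡.≡-Reasoning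

  addrs-unique : ∀ j → Unique (addrs k j)
  addrs-unique zero    = Unique.map⁺ (cong proj₁) (Unique.allFin⁺ k)
  addrs-unique (suc j) = subst Unique (≡.sym (addrs-suc j))
    (Unique.cartesianProductWith⁺ extend (λ { {_ , _} {_ , _} refl → refl , refl })
      (addrs-unique j) (Unique.allFin⁺ (k ∸ 2)))

  data Node : ℕ → Set where
    root : Node 0
    node : ∀ {j} → Fin k → Vec (Fin (k ∸ 2)) j → Node (suc j)

  father : ∀ {j} → Node (suc j) → Node j
  father (node i [])       = root
  father (node i (_ ∷ as)) = node i as

  _≟_ : ∀ {j} (x y : Node j) → Dec (x ≡ y)
  root      ≟ root        = yes refl
  node i as ≟ node i′ as′ with i F.≟ i′ | Data.Vec.Properties.≡-dec F._≟_ as as′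
  ... | yes refl | yes refl = yes refl
  ... | no i≢i′  | _        = no λ { refl → i≢i′ refl }
  ... | _        | no as≢   = no λ { refl → as≢ refl }

  data AncestorAt : ∀ {a b} → ℕ → Node a → Node b → Set where
    self : ∀ {a} {x : Node a} → AncestorAt 0 x x
    up   : ∀ {a b d} {x : Node (suc a)} {y : Node b} → AncestorAt d (father x) y → AncestorAt (suc d) x y

  AncestorAt-level : ∀ {a b d} {x : Node a} {y : Node b} → AncestorAt d x y → a ≡ d + b
  AncestorAt-level self   = refl
  AncestorAt-level (up p) = cong suc (AncestorAt-level p)

  AncestorAt-level≤ : ∀ {a b d m} {x : Node a} {y : Node b} → AncestorAt d x y → a ≤ m → b ≤ m
  AncestorAt-level≤ {d = d} x↑y a≤m = ℕ.≤-trans (ℕ.m≤n+m _ d) (subst (_≤ _) (AncestorAt-level x↑y) a≤m)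

  AncestorAt-generations< : ∀ {a b d m} {x : Node a} {y : Node (suc b)} → AncestorAt d x y → a ≤ m → suc d ≤ m
  AncestorAt-generations< {b = b} {d} x↑y a≤m =
    ℕ.≤-trans (subst (_≤ d + suc b) (ℕ.+-comm d 1) (ℕ.+-monoʳ-≤ d (s≤s z≤n)))
              (subst (_≤ _) (AncestorAt-level x↑y) a≤m)

  AncestorAt-father : ∀ {a b d} {x : Node a} {y : Node (suc b)} →
                      AncestorAt d x y → AncestorAt (suc d) x (father y)
  AncestorAt-father self   = up self
  AncestorAt-father (up p) = up (AncestorAt-father p)

  AncestorAt-trans : ∀ {a b c d e} {x : Node a} {y : Node b} {z : Node c} →
                     AncestorAt d x y → AncestorAt e y z → AncestorAt (d + e) x z
  AncestorAt-trans self   q = q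
  AncestorAt-trans (up p) q = up (AncestorAt-trans p q)

  AncestorAt-child : ∀ {a b d} {x : Node a} {y : Node b} → AncestorAt (suc d) x y →
                     Σ (Node (suc b)) λ c → AncestorAt d x c × father c ≡ y
  AncestorAt-child {x = x} (up self) = x , self , refl
  AncestorAt-child (up (up p)) with AncestorAt-child (up p)
  ... | c , x↑c , refl = c , up x↑c , refl

  ancestorAtLevel : ∀ {a b} → b ≤ a → (x : Node a) → ∃[ d ] Σ (Node b) (AncestorAt d x)
  ancestorAtLevel b≤a x with ℕ.m≤n⇒m<n∨m≡n b≤a
  ... | inj₂ refl       = 0 , x , self
  ... | inj₁ (s≤s b≤a′) with ancestorAtLevel b≤a′ (father x)
  ...   | d , y , x↑y = suc d , y , up x↑y

  divergence : ∀ {b} (x y : Node b) → x ≢ y →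
    ∃[ c ] Σ (Node (suc c)) λ C₁ → Σ (Node (suc c)) λ C₂ →
      father C₁ ≡ father C₂ × C₁ ≢ C₂ × ∃[ e ] AncestorAt e x C₁ × AncestorAt e y C₂
  divergence {zero}  root root x≢y = ⊥-elim (x≢y refl)
  divergence {suc b} x    y    x≢y with father x ≟ father y
  ... | yes eq = _ , x , y , eq , x≢y , 0 , self , self
  ... | no f≢f with divergence (father x) (father y) f≢f
  ...   | c , C₁ , C₂ , eq , C₁≢C₂ , e , x↑ , y↑ = c , C₁ , C₂ , eq , C₁≢C₂ , suc e , up x↑ , up y↑

module Tree {n : ℕ} (G : Graph n) (l k h : ℕ) {{_ : NonZero k}} (1≤h : 1 ≤ h)
            (girth : GirthAtLeast G (10 * h * l)) (C : Construction G l k h) where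
  open Walks G
  open PathWalks G l
  open Construction C using (R; partR; W; partW; sel; level1; selInj; selFree; child)
  open AddressTree k

  walk : ∀ {j} → Node j → Path G l
  walk root        = R
  walk (node i as) = W _ i as

  partition : ∀ {j} → Node j → Partition l k
  partition root        = partR
  partition (node i as) = partW _ i as

  slot : ∀ {j} → Node (suc j) → Fin k
  slot (node i [])       = i
  slot (node i (a ∷ as)) = sel _ i as a

  attached : ∀ {j} (x : Node (suc j)) → suc j ≤ h →
             AttachedTo (walk x) (walk (father x)) (partition (father x)) (slot x)
  attached (node i [])       = level1 i
  attached (node i (a ∷ as)) = child _ i as a

  free : ∀ {j} (x : Node (suc (suc j))) → suc (suc j) ≤ h →
         Free (walk (father x)) (partition (father x)) (slot x) (walk (father (father x)))
  free (node i (a ∷ []))     = selFree _ i [] a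
  free (node i (a ∷ b ∷ as)) = selFree _ i (b ∷ as) a

  slot-injective : ∀ {j} {x y : Node (suc j)} → suc j ≤ h → father x ≡ father y → slot x ≡ slot y → x ≡ y
  slot-injective {x = node i []}       {node i′ []}        _   _    refl = refl
  slot-injective {x = node i (a ∷ as)} {node .i (a′ ∷ .as)} j<h refl eq   =
    cong (λ b → node i (b ∷ as)) (selInj _ i as j<h eq)

  FarApartDisjoint : ℕ → Set
  FarApartDisjoint d = ∀ {a b} (x : Node a) (y : Node b) → a ≤ h → AncestorAt (suc (suc d)) x y →
                       Disjoint (walk x) (walk y)

  record Ascent {a c} (x : Node a) (A : Node c) (s : Fin k) (d : ℕ) (t : Fin (suc l)) : Set where
    field
      end        : Fin (suc l)
      end-inside : Inside (partition A) s (toℕ end)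
      path       : Walk (vert (walk x) t) (vert (walk A) end)
      short      : lengthʷ path ≤ suc d * l
      avoids     : ∀ m → ¬ Inside (partition A) s (toℕ m) → vert (walk A) m ∉ vertices path

  -- Below C the route runs on nodes at least two generations below father C, which miss it by
  -- hypothesis; C itself meets its father only inside its slot.
  climb : ∀ {a b d} {x : Node a} {C : Node (suc b)} → AncestorAt d x C → a ≤ h →
          (∀ {e} → e < d → FarApartDisjoint e) → (t : Fin (suc l)) → Ascent x (father C) (slot C) d t
  climb {x = x} self a≤h _ t with attached x a≤h
  ... | (z , (t₁ , t₁≡z) , z∈A) , inside-at with inside-at z (t₁ , t₁≡z) z∈A
  ...   | T , T≡z , T-inside = record
    { end        = T
    ; end-inside = T-inside
    ; path       = piece
    ; short      = ℕ.≤-trans (lengthʷ-route (walk x) t t₁ refl _) (ℕ.m≤m+n l 0)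
    ; avoids     = avoids }
    where
    piece = route (walk x) t t₁ refl (trans t₁≡z (≡.sym T≡z))
    avoids : ∀ m → ¬ Inside (partition (father x)) (slot x) (toℕ m) →
             vert (walk (father x)) m ∉ vertices piece
    avoids m m∉ m∈ with inside-at _ (∈-route⁻ (walk x) t t₁ refl _ m∈) (m , refl)
    ... | m′ , m′≡m , m′-inside with inj (walk (father x)) m′≡m
    ...   | refl = m∉ m′-inside
  climb {x = x} {C} (up x↑) a≤h ih t with attached x a≤h
  ... | (z , (t₁ , t₁≡z) , (f , f≡z)) , _ = record
    { end        = Ascent.end rest
    ; end-inside = Ascent.end-inside rest
    ; path       = piece ++ʷ Ascent.path rest
    ; short      = subst (_≤ l + _) (≡.sym (lengthʷ-++ʷ piece (Ascent.path rest)))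
                     (ℕ.+-mono-≤ (lengthʷ-route (walk x) t t₁ refl _) (Ascent.short rest))
    ; avoids     = avoids }
    where
    rest = climb x↑ (ℕ.≤-trans (ℕ.n≤1+n _) a≤h) (λ e<d → ih (ℕ.m≤n⇒m≤1+n e<d)) f
    piece = route (walk x) t t₁ refl (trans t₁≡z (≡.sym f≡z))
    avoids : ∀ m → ¬ Inside (partition (father C)) (slot C) (toℕ m) →
             vert (walk (father C)) m ∉ vertices (piece ++ʷ Ascent.path rest)
    avoids m m∉ m∈ with ∈-++ʷ⁻ piece (Ascent.path rest) m∈
    ... | inj₁ m∈x    = ih ℕ.≤-refl x (father C) a≤h (AncestorAt-father (up x↑))
                          (_ , ∈-route⁻ (walk x) t t₁ refl _ m∈x , (m , refl))
    ... | inj₂ m∈rest = Ascent.avoids rest m m∉ m∈rest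

  -- Going along Y from where C₁ = father C₂ meets it to the shared vertex, then climbing from x
  -- into the slot of C₂ on C₁: as that slot is free, the detour misses one of its endpoints.
  grandfather-disjoint : ∀ {a b d} (x : Node a) (C₂ : Node (suc (suc b))) → a ≤ h →
    (∀ {e} → e < d → FarApartDisjoint e) → AncestorAt d x C₂ → Disjoint (walk x) (walk (father (father C₂)))
  grandfather-disjoint {d = d} x C₂ a≤h ih x↑C₂ (v , (tx , tx≡v) , (ty , ty≡v))
    with attached (father C₂) (ℕ.≤-trans (ℕ.n≤1+n _) (AncestorAt-level≤ x↑C₂ a≤h))
  ... | (z , (t₁ , t₁≡z) , (f₁ , f₁≡z)) , _ =
    around (endpoint-between-outside-inside C₁-parts t₁ (Ascent.end ascent)
              (λ (lo , hi) → Y-misses-slot t₁ lo hi (f₁ , trans f₁≡z (≡.sym t₁≡z)))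
              (Ascent.end-inside ascent))
    where
    C₁ = father C₂
    Y  = father C₁
    C₁-parts = partition C₁
    ascent = climb x↑C₂ a≤h ih tx
    Y-misses-slot = free C₂ (AncestorAt-level≤ x↑C₂ a≤h)
    along-Y = route (walk Y) f₁ ty (trans f₁≡z (≡.sym t₁≡z)) (trans ty≡v (≡.sym tx≡v))
    detour = along-Y ++ʷ Ascent.path ascent
    around : ∃[ m ] Between (toℕ t₁) (toℕ m) (toℕ (Ascent.end ascent))
               × Within C₁-parts (slot C₂) (toℕ m) × ¬ Inside C₁-parts (slot C₂) (toℕ m) → ⊥
    around (m , between , (lo , hi) , m-not-inside) =
      girth-forbids (3 + d) 1≤h girth (detour⇒cycle (walk C₁) t₁ m (Ascent.end ascent) between detour m∉)
        (ℕ.+-monoʳ-≤ l (subst (_≤ l + suc d * l) (≡.sym (lengthʷ-++ʷ along-Y (Ascent.path ascent)))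
          (ℕ.+-mono-≤ (lengthʷ-route (walk Y) f₁ ty _ _) (Ascent.short ascent))))
        (s≤s (ℕ.≤-trans (AncestorAt-generations< (AncestorAt-father x↑C₂) a≤h) (ℕ.m≤m+n h h)))
      where
      m∉ : vert (walk C₁) m ∉ vertices detour
      m∉ m∈ with ∈-++ʷ⁻ along-Y (Ascent.path ascent) m∈
      ... | inj₁ m∈Y    = Y-misses-slot m lo hi (∈-route⁻ (walk Y) f₁ ty _ _ m∈Y)
      ... | inj₂ m∈path = Ascent.avoids ascent m m-not-inside m∈path

  far-apart-disjoint : ∀ d → FarApartDisjoint d
  far-apart-disjoint = <-rec FarApartDisjoint from-closer
    where
    from-closer : ∀ d → (∀ {e} → e < d → FarApartDisjoint e) → FarApartDisjoint d
    from-closer d ih x y a≤h x↑y with AncestorAt-child x↑y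
    ... | C₁ , x↑C₁ , refl with AncestorAt-child x↑C₁
    ...   | C₂ , x↑C₂ , refl = grandfather-disjoint x C₂ a≤h ih x↑C₂

  -- Climbing from a shared vertex into the slots of C₁ and C₂ on their father gives a detour
  -- that misses an endpoint separating the two slots.
  cousins-disjoint : ∀ {a b c e₁ e₂} {x : Node a} {y : Node b} {C₁ C₂ : Node (suc c)} →
    father C₁ ≡ father C₂ → C₁ ≢ C₂ → AncestorAt e₁ x C₁ → AncestorAt e₂ y C₂ → a ≤ h → b ≤ h →
    Disjoint (walk x) (walk y)
  cousins-disjoint {e₁ = e₁} {e₂} {x} {y} {C₁} {C₂} same-father C₁≢C₂ x↑C₁ y↑C₂ a≤h b≤h
                   (v , (tx , tx≡v) , (ty , ty≡v)) =
    around (endpoint-between-slots (partition A) (Ascent.end ascent₁) (Ascent.end ascent₂) slots≢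
              (Ascent.end-inside ascent₁) (Ascent.end-inside ascent₂))
    where
    A = father C₁
    ascent₁ : Ascent x A (slot C₁) e₁ tx
    ascent₁ = climb x↑C₁ a≤h (λ _ → far-apart-disjoint _) tx
    ascent₂ : Ascent y A (slot C₂) e₂ ty
    ascent₂ = subst (λ B → Ascent y B (slot C₂) e₂ ty) (≡.sym same-father)
                (climb y↑C₂ b≤h (λ _ → far-apart-disjoint _) ty)
    slots≢ : slot C₁ ≢ slot C₂
    slots≢ eq = C₁≢C₂ (slot-injective (AncestorAt-level≤ x↑C₁ a≤h) same-father eq)
    down = reverseʷ (Ascent.path ascent₁)
    up′  = castʷ (trans ty≡v (≡.sym tx≡v)) refl (Ascent.path ascent₂)
    detour = down ++ʷ up′
    around : ∃[ m ] Between (toℕ (Ascent.end ascent₁)) (toℕ m) (toℕ (Ascent.end ascent₂))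
               × ¬ Inside (partition A) (slot C₁) (toℕ m) × ¬ Inside (partition A) (slot C₂) (toℕ m) → ⊥
    around (m , between , m∉₁ , m∉₂) =
      girth-forbids (suc (suc e₁ + suc e₂)) 1≤h girth
        (detour⇒cycle (walk A) (Ascent.end ascent₁) m (Ascent.end ascent₂) between detour m∉)
        (ℕ.+-monoʳ-≤ l (subst (_≤ (suc e₁ + suc e₂) * l) (≡.sym (lengthʷ-++ʷ down up′)) detour-short))
        (s≤s (ℕ.+-mono-≤ (AncestorAt-generations< x↑C₁ a≤h) (AncestorAt-generations< y↑C₂ b≤h)))
      where
      m∉ : vert (walk A) m ∉ vertices detour
      m∉ m∈ with ∈-++ʷ⁻ down up′ m∈
      ... | inj₁ m∈down = Ascent.avoids ascent₁ m m∉₁ (∈-reverseʷ⁻ _ m∈down)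
      ... | inj₂ m∈up   = Ascent.avoids ascent₂ m m∉₂ (subst (_ ∈_) (vertices-castʷ _ refl _) m∈up)
      detour-short : lengthʷ down + lengthʷ up′ ≤ (suc e₁ + suc e₂) * l
      detour-short = subst₂ (λ p q → p + q ≤ (suc e₁ + suc e₂) * l)
        (≡.sym (lengthʷ-reverseʷ (Ascent.path ascent₁))) (≡.sym (lengthʷ-castʷ _ refl (Ascent.path ascent₂)))
        (subst (lengthʷ (Ascent.path ascent₁) + lengthʷ (Ascent.path ascent₂) ≤_)
          (≡.sym (ℕ.*-distribʳ-+ l (suc e₁) (suc e₂)))
          (ℕ.+-mono-≤ (Ascent.short ascent₁) (Ascent.short ascent₂)))

  meeting⇒self-or-father : ∀ {a b} (x : Node a) (y : Node b) → a ≤ h → b ≤ h → b ≤ a →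
    Meets (walk x) (walk y) → AncestorAt 0 x y ⊎ AncestorAt 1 x y
  meeting⇒self-or-father x y a≤h b≤h b≤a meet with ancestorAtLevel b≤a x
  ... | d , x′ , x↑x′ with x′ ≟ y
  ...   | no x′≢y with divergence x′ y x′≢y
  ...     | _ , _ , _ , same-father , C₁≢C₂ , _ , x′↑C₁ , y↑C₂ =
            ⊥-elim (cousins-disjoint same-father C₁≢C₂ (AncestorAt-trans x↑x′ x′↑C₁) y↑C₂ a≤h b≤h meet)
  meeting⇒self-or-father x y a≤h b≤h b≤a meet | _ , _ , self      | yes refl = inj₁ self
  meeting⇒self-or-father x y a≤h b≤h b≤a meet | _ , _ , up self   | yes refl = inj₂ (up self)
  meeting⇒self-or-father x y a≤h b≤h b≤a meet | _ , _ , up (up p) | yes refl =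
    ⊥-elim (far-apart-disjoint _ x y a≤h (up (up p)) meet)

  distinct-disjoint : ∀ {a} {x y : Node a} → a ≤ h → x ≢ y → Disjoint (walk x) (walk y)
  distinct-disjoint {x = x} {y} a≤h x≢y meet with meeting⇒self-or-father x y a≤h a≤h ℕ.≤-refl meet
  ... | inj₁ self = x≢y refl
  ... | inj₂ x↑y  = ℕ.1+n≢n (≡.sym (AncestorAt-level x↑y))

  ∈-level⁻ : ∀ j {X} → X ∈ levelOf R W j → Σ (Node j) λ y → X ≡ walk y
  ∈-level⁻ zero    (here X≡R) = root , X≡R
  ∈-level⁻ (suc j) X∈ with ∈-map⁻ _ X∈
  ... | (i , as) , _ , X≡ = node i as , X≡

  father-walk : ∀ {j} (i : Fin k) (as : Vec (Fin (k ∸ 2)) j) → fatherOf R W j i as ≡ walk (father (node i as))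
  father-walk i []       = refl
  father-walk i (_ ∷ as) = refl

  level-disjoint : ∀ j → suc j ≤ h → AllPairs Disjoint (levelOf R W (suc j))
  level-disjoint j j<h = AllPairsₚ.map⁺ (AllPairs.map (λ p≢q → distinct-disjoint j<h (p≢q ∘ node-injective))
                                                     (addrs-unique j))
    where
    node-injective : ∀ {i i′ : Fin k} {as as′ : Vec (Fin (k ∸ 2)) j} →
                     node i as ≡ node i′ as′ → (i , as) ≡ (i′ , as′)
    node-injective refl = refl

  meets-only-father : ∀ j → suc j ≤ h → (i : Fin k) (as : Vec (Fin (k ∸ 2)) j) →
    ∀ j′ → j′ ≤ j → ∀ X → X ∈ levelOf R W j′ → Meets (W j i as) X → SameVertices X (fatherOf R W j i as)
  meets-only-father j j<h i as j′ j′≤j X X∈ meet with ∈-level⁻ j′ X∈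
  ... | y , refl with meeting⇒self-or-father (node i as) y j<h (ℕ.≤-trans j′≤j (ℕ.≤-trans (ℕ.n≤1+n j) j<h))
                        (ℕ.m≤n⇒m≤1+n j′≤j) meet
  ...   | inj₁ x↑y      = ⊥-elim (ℕ.<⇒≢ (s≤s j′≤j) (≡.sym (AncestorAt-level x↑y)))
  ...   | inj₂ (up self) rewrite father-walk i as = λ _ → ⇔-refl

mainTheorem14 : ∀ {n d : ℕ} (G : Graph n) → Regular G d →
    (l k h : ℕ) {{_ : NonZero k}} → 4 ≤ k → 1 ≤ h →
    GirthAtLeast G (10 * h * l) →
    (C : Construction G l k h) →
    ∀ (j : ℕ) → suc j ≤ h →
      (length (Construction.level C (suc j)) ≡ k * (k ∸ 2) ^ j)
      × AllPairs Disjoint (Construction.level C (suc j))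
      × (∀ (i : Fin k) (as : Vec (Fin (k ∸ 2)) j) →
           Meets (Construction.W C j i as) (Construction.father C j i as)
           × (∀ (j' : ℕ) → j' ≤ j → ∀ X → X ∈ Construction.level C j' →
                Meets (Construction.W C j i as) X →
                SameVertices X (Construction.father C j i as)))
mainTheorem14 G _ l k h _ 1≤h girth C j j<h =
    trans (length-map _ (addrs k j)) (length-addrs j)
  , level-disjoint j j<h
  , λ i as → subst (Meets (walk (node i as))) (≡.sym (father-walk i as)) (proj₁ (attached (node i as) j<h))
           , meets-only-father j j<h i as
  where
  open AddressTree k
  open Tree G l k h 1≤h girth C
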